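{- Let $q$ be an odd prime and let $B$ be a finite set of nonzero integers. If $B$ is a minimal locally $q^{th}$ power set, then $|B| = |\pi_{q}(B)|$.
   Context: A perfect $q^{th}$ power is the $q$-th power of an integer. A finite set $B$ of nonzero integers is a locally $q^{th}$ power set if $B$ contains no perfect $q^{th}$ power but, for all but finitely many primes $p$, some element of $B$ is a $q^{th}$ power modulo $p$. An element $b$ of a locally $q^{th}$ power set $B$ is essential if $B\setminus\{b\}$ is not a locally $q^{th}$ power set; $B$ is minimal if every element of $B$ is essential. For nonzero integers $b_1=\pm\prod_i p_i^{\mu_i}$, $b_2=\pm\prod_i p_i^{\nu_i}$ (over all primes $p_i$ dividing $b_1b_2$), write $b_1\sim_q b_2$ iff $\mu_i\equiv \nu_i \pmod q$ for all $i$. The map $\pi_q$ sends a nonzero integer to its $\sim_q$-class, and $\pi_q(B)=\{\pi_q(b): b\in B\}$. Equivalently, the class of $b$ is identified with the $q$-free part $\mathrm{rad}_q(|b|)=\prod_i p_i^{a_i \bmod q}$ where $|b|=\prod_i p_i^{a_i}$. -}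

module Defs where

open import Data.Nat as ℕ using (ℕ; suc; _<_; _%_)
open import Data.Nat.Primality using (Prime)
open import Data.Integer as ℤ using (ℤ; +_; ∣_∣; _-_)
import Data.Integer.Divisibility as ℤD
import Data.Nat.Divisibility as ℕD
open import Data.List using (List; []; _∷_; length)
open import Data.List.Relation.Unary.Any using (Any)
open import Data.List.Membership.Propositional using (_∈_)
open import Data.Product using (_×_; ∃-syntax)
open import Relation.Nullary using (¬_)
open import Relation.Binary.PropositionalEquality using (_≡_; _≢_)

PerfectPower : ℕ → ℤ → Set
PerfectPower q b = ∃[ x ] (x ℤ.^ q ≡ b)

PowerModP : ℕ → ℤ → ℕ → Set
PowerModP q b p = ∃[ x ] ((+ p) ℤD.∣ (x ℤ.^ q - b))

-- A set S of integers (given as a predicate) is a locally q-th power set: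
-- it contains no perfect q-th power, and for all but finitely many primes p
-- (i.e. all primes p > N for some N) some element of S is a q-th power mod p.
LocallyQthPowerSet : ℕ → (ℤ → Set) → Set
LocallyQthPowerSet q S =
  (∀ b → S b → ¬ PerfectPower q b) ×
  ∃[ N ] (∀ p → Prime p → N < p → ∃[ b ] (S b × PowerModP q b p))

MinimalLocallyQthPowerSet : ℕ → List ℤ → Set
MinimalLocallyQthPowerSet q B =
  LocallyQthPowerSet q (_∈ B) ×
  (∀ b → b ∈ B → ¬ LocallyQthPowerSet q (λ c → c ∈ B × c ≢ b))

-- p^k exactly divides n (k is the p-adic valuation of n, for n ≠ 0)
ExactPower : ℕ → ℕ → ℕ → Set
ExactPower p k n = (p ℕ.^ k) ℕD.∣ n × ¬ ((p ℕ.^ suc k) ℕD.∣ n)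

_∼[_]_ : ℤ → ℕ → ℤ → Set
b₁ ∼[ q ] b₂ = ∀ p → Prime p → ∀ k l →
  ExactPower p k ∣ b₁ ∣ → ExactPower p l ∣ b₂ ∣ → (+ q) ℤD.∣ (+ k - + l)

-- NumClasses R B k : the list B meets exactly k classes of the equivalence
-- relation R, i.e. |π(B)| = k where π is the quotient map.  An element is
-- counted iff no later element of the list is R-related to it.
data NumClasses (R : ℤ → ℤ → Set) : List ℤ → ℕ → Set where
  nc-[]  : NumClasses R [] 0
  nc-new : ∀ {b B k} → ¬ Any (R b) B → NumClasses R B k → NumClasses R (b ∷ B) (suc k)
  nc-old : ∀ {b B k} → Any (R b) B → NumClasses R B k → NumClasses R (b ∷ B) k

{-# OPTIONS --safe #-}
module Submission where

-- If b₁ ≠ b₂ in B satisfy b₁ ∼_q b₂, then |b₁| = u^q r and |b₂| = v^q r for a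
-- common r: cancel, one prime p at a time, either p from both sides or p^q from
-- the one side it divides (there its exponent is a positive multiple of q).  As
-- q is odd the signs can be absorbed: b₁ = U^q R and b₂ = V^q R.  For a prime
-- p > |V|, V has an inverse W mod p, so b₂ ≡ y^q (mod p) gives
-- b₁ ≡ (U W y)^q (mod p).  Hence B ∖ {b₂} is still a locally q-th power set,
-- contradicting the essentiality of b₂; so distinct elements of B lie in
-- distinct ∼_q-classes.

open import Defs
open import Data.Nat using (ℕ; _%_)
open import Data.Nat.Primality using (Prime)
open import Data.Integer using (ℤ; 0ℤ)
open import Data.List using (List; length)
open import Data.List.Relation.Unary.All using (All)
open import Data.List.Relation.Unary.Unique.Propositional using (Unique)
open import Relation.Binary.PropositionalEquality using (_≡_; _≢_)

open import Data.Nat.Base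
open import Data.Nat.Properties
open import Data.Nat.Divisibility
open import Data.Nat.Primality
open import Data.Nat.Primality.Factorisation using (factorise)
open import Data.Nat.Coprimality using (prime⇒coprime; coprime-Bézout)
open import Data.Nat.GCD using (module Bézout)
open import Data.Nat.ListAction using (product)
open import Data.Nat.Induction using (<-wellFounded)
open import Induction.WellFounded using (Acc; acc)
open import Data.Integer.Base as ℤ using (+_; -_; -[1+_]; 1ℤ)
import Data.Integer.Properties as ℤ
import Data.Integer.Divisibility as ℤD
import Data.Integer.Divisibility.Signed as ℤS
open import Data.Integer.Tactic.RingSolver using (solve-∀)
open import Data.List.Base using ([]; _∷_)
open import Data.List.Membership.Propositional using (_∈_)
open import Data.List.Relation.Unary.Any using (here; there)
open import Data.List.Relation.Unary.All using (_∷_)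
import Data.List.Relation.Unary.All as All
open import Data.List.Relation.Unary.All.Properties using (All¬⇒¬Any)
open import Data.List.Relation.Unary.AllPairs using (_∷_; [])
open import Data.Product using (_,_; _×_; ∃-syntax)
open import Data.Sum using (_⊎_; inj₁; inj₂)
open import Function.Base using (_∘_)
open import Relation.Nullary using (¬_; yes; no; contradiction)
open import Relation.Binary.PropositionalEquality
  using (refl; sym; trans; cong; cong₂; subst; subst₂; module ≡-Reasoning)

infix 4 _≡_[mod_]

_≡_[mod_] : ℕ → ℕ → ℕ → Set
k ≡ l [mod q ] = + q ℤD.∣ + k ℤ.- + l

module _ {q : ℕ} where

  ≡[mod]-refl : ∀ k → k ≡ k [mod q ]
  ≡[mod]-refl k = subst (λ z → q ∣ ℤ.∣ z ∣) (sym (ℤ.+-inverseʳ (+ k))) (q ∣0)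

  ≡[mod]-sym : ∀ {k l} → k ≡ l [mod q ] → l ≡ k [mod q ]
  ≡[mod]-sym {k} {l} = subst (q ∣_) (ℤ.∣i-j∣≡∣j-i∣ (+ k) (+ l))

  ≡[mod]-cancelʳ : ∀ {k l i j} → k + i ≡ l + j [mod q ] → i ≡ j [mod q ] → k ≡ l [mod q ]
  ≡[mod]-cancelʳ {k} {l} {i} {j} k+i≡l+j i≡j =
    ℤS.∣⇒∣ᵤ (subst (+ q ℤS.∣_) difference
      (ℤS.∣m∣n⇒∣m-n (ℤS.∣ᵤ⇒∣ {i = + (k + i) ℤ.- + (l + j)} k+i≡l+j)
                     (ℤS.∣ᵤ⇒∣ {i = + i ℤ.- + j} i≡j)))
    where
    cancel : ∀ a b c d → a ℤ.+ b ℤ.- (c ℤ.+ d) ℤ.- (b ℤ.- d) ≡ a ℤ.- c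
    cancel = solve-∀
    difference : + (k + i) ℤ.- + (l + j) ℤ.- (+ i ℤ.- + j) ≡ + k ℤ.- + l
    difference = trans (cong₂ (λ x y → x ℤ.- y ℤ.- (+ i ℤ.- + j)) (ℤ.pos-+ k i) (ℤ.pos-+ l j))
                       (cancel (+ k) (+ i) (+ l) (+ j))

  n≡0[mod]⇒∣ : ∀ {n} → n ≡ 0 [mod q ] → q ∣ n
  n≡0[mod]⇒∣ {n} = subst (λ z → q ∣ ℤ.∣ z ∣) (ℤ.+-identityʳ (+ n))

  q≡0[mod]q : q ≡ 0 [mod q ]
  q≡0[mod]q = subst (q ∣_) (sym (+-identityʳ q)) ∣-refl

∤⇒exactPower-0 : ∀ {p a} → ¬ p ∣ a → ExactPower p 0 a
∤⇒exactPower-0 {p} {a} p∤a = 1∣ a , λ p*1∣a → p∤a (subst (_∣ a) (*-identityʳ p) p*1∣a)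

exactPower-*^ : ∀ {p k a} i → .{{NonZero p}} → ExactPower p k a → ExactPower p (k + i) (a * p ^ i)
exactPower-*^ {p} {k} {a} i (p^k∣a , p^1+k∤a) =
  subst (_∣ a * p ^ i) (sym (^-distribˡ-+-* p k i)) (*-monoˡ-∣ (p ^ i) p^k∣a) ,
  p^1+k∤a ∘ *-cancelʳ-∣ (p ^ i) {{m^n≢0 p i}} ∘ subst (_∣ a * p ^ i) (^-distribˡ-+-* p (suc k) i)

prime∤1 : ∀ {p} → Prime p → ¬ p ∣ 1
prime∤1 pp = nonTrivial⇒≢1 {{prime⇒nonTrivial pp}} ∘ ∣1⇒≡1

prime∤prime : ∀ {p p′} → Prime p → Prime p′ → p ≢ p′ → ¬ p ∣ p′
prime∤prime pp pp′ p≢p′ p∣p′ with prime⇒irreducible pp′ p∣p′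
... | inj₁ p≡1 = nonTrivial⇒≢1 {{prime⇒nonTrivial pp}} p≡1
... | inj₂ p≡p′ = p≢p′ p≡p′

prime∤^ : ∀ {p c} → Prime p → ¬ p ∣ c → ∀ n → ¬ p ∣ c ^ n
prime∤^ pp p∤c zero = prime∤1 pp
prime∤^ {c = c} pp p∤c (suc n) p∣c*c^n with euclidsLemma c (c ^ n) pp p∣c*c^n
... | inj₁ p∣c = p∤c p∣c
... | inj₂ p∣c^n = prime∤^ pp p∤c n p∣c^n

prime^∣*-∤⇒∣ : ∀ {p c} → Prime p → ¬ p ∣ c → ∀ n {a} → p ^ n ∣ c * a → p ^ n ∣ a
prime^∣*-∤⇒∣ pp p∤c zero _ = 1∣ _
prime^∣*-∤⇒∣ {p} {c} pp p∤c (suc n) {a} p*p^n∣c*a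
  with euclidsLemma c a pp (m*n∣⇒m∣ p (p ^ n) p*p^n∣c*a)
... | inj₁ p∣c = contradiction p∣c p∤c
... | inj₂ (divides a′ refl) = subst (p * p ^ n ∣_) (*-comm p a′) (*-monoʳ-∣ p p^n∣a′)
  where
  instance _ = prime⇒nonZero pp
  c*[a′*p]≡p*[c*a′] : c * (a′ * p) ≡ p * (c * a′)
  c*[a′*p]≡p*[c*a′] = trans (sym (*-assoc c a′ p)) (*-comm (c * a′) p)
  p^n∣a′ : p ^ n ∣ a′
  p^n∣a′ = prime^∣*-∤⇒∣ pp p∤c n (*-cancelˡ-∣ p (subst (p * p ^ n ∣_) c*[a′*p]≡p*[c*a′] p*p^n∣c*a))

exactPower-*∤ : ∀ {p c k a} → Prime p → ¬ p ∣ c → ExactPower p k a → ExactPower p k (a * c)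
exactPower-*∤ {p} {c} {k} {a} pp p∤c (p^k∣a , p^1+k∤a) =
  ∣m⇒∣m*n c p^k∣a ,
  p^1+k∤a ∘ prime^∣*-∤⇒∣ pp p∤c (suc k) ∘ subst (p ^ suc k ∣_) (*-comm a c)

exactPower-exists : ∀ {p} → Prime p → ∀ a → .{{NonZero a}} → ∃[ k ] ExactPower p k a
exactPower-exists {p} pp a = go a (<-wellFounded a)
  where
  instance _ = prime⇒nonZero pp
  go : ∀ a → .{{NonZero a}} → Acc _<_ a → ∃[ k ] ExactPower p k a
  go a (acc rec) with p ∣? a
  ... | no p∤a = 0 , ∤⇒exactPower-0 p∤a
  ... | yes (divides a′ refl) =
    let instance _ = m*n≢0⇒m≢0 a′
        (k , a′-exact) = go a′ (rec (m<m*n a′ p (nonTrivial⇒n>1 p {{prime⇒nonTrivial pp}})))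
    in k + 1 , subst (ExactPower p (k + 1)) (cong (a′ *_) (*-identityʳ p))
                     (exactPower-*^ {p} {k} 1 a′-exact)

≡1⊎primeDivisor : ∀ n → .{{NonZero n}} → n ≡ 1 ⊎ ∃[ p ] (Prime p × p ∣ n)
≡1⊎primeDivisor n with factorise n
... | record { factors = [] ; isFactorisation = n≡1 } = inj₁ n≡1
... | record { factors = p ∷ ps ; isFactorisation = n≡p*Πps ; factorsPrime = pp ∷ _ } =
  inj₂ (p , pp , subst (p ∣_) (sym n≡p*Πps) (m∣m*n (product ps)))

m≤n⇒p^m∣p^n : ∀ p {m n} → m ≤ n → p ^ m ∣ p ^ n
m≤n⇒p^m∣p^n p {m} {n} m≤n = divides (p ^ (n ∸ m)) (begin
  p ^ n               ≡⟨ cong (p ^_) (m+[n∸m]≡n m≤n) ⟨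
  p ^ (m + (n ∸ m))   ≡⟨ ^-distribˡ-+-* p m (n ∸ m) ⟩
  p ^ m * p ^ (n ∸ m) ≡⟨ *-comm (p ^ m) (p ^ (n ∸ m)) ⟩
  p ^ (n ∸ m) * p ^ m ∎)
  where open ≡-Reasoning

-- b₁ ∼[ q ] b₂ unfolds to ∣ b₁ ∣ ≈[ q ] ∣ b₂ ∣.
infix 4 _≈[_]_

_≈[_]_ : ℕ → ℕ → ℕ → Set
a ≈[ q ] b = (+ a) ∼[ q ] (+ b)

≈-sym : ∀ {q a b} → a ≈[ q ] b → b ≈[ q ] a
≈-sym a≈b p pp k l b-exact a-exact = ≡[mod]-sym {k = l} {k} (a≈b p pp l k a-exact b-exact)

≈-divide : ∀ {q p i j a b a′ b′} → Prime p → a ≡ a′ * p ^ i → b ≡ b′ * p ^ j →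
           i ≡ j [mod q ] → a ≈[ q ] b → a′ ≈[ q ] b′
≈-divide {p = p} {i} {j} pp refl refl i≡j a≈b p′ pp′ k l a′-exact b′-exact with p′ ≟ p
... | yes refl = ≡[mod]-cancelʳ {k = k} {l} {i} {j} (a≈b p pp (k + i) (l + j)
                   (exactPower-*^ {k = k} i a′-exact) (exactPower-*^ {k = l} j b′-exact)) i≡j
  where instance _ = prime⇒nonZero pp
... | no p′≢p = a≈b p′ pp′ k l (exactPower-*∤ {k = k} pp′ (p′∤p^ i) a′-exact)
                               (exactPower-*∤ {k = l} pp′ (p′∤p^ j) b′-exact)
  where
  p′∤p^ : ∀ n → ¬ p′ ∣ p ^ n
  p′∤p^ = prime∤^ pp′ (prime∤prime pp′ pp p′≢p)

≈-∣∧∤⇒^∣ : ∀ {q p a b} → .{{NonZero a}} → Prime p → p ∣ a → ¬ p ∣ b → a ≈[ q ] b → p ^ q ∣ a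
≈-∣∧∤⇒^∣ {q} {p} {a} pp p∣a p∤b a≈b with exactPower-exists pp a
... | zero , (_ , p∤a) = contradiction (subst (_∣ a) (sym (*-identityʳ p)) p∣a) p∤a
... | k@(suc _) , a-exact@(p^k∣a , _) =
  ∣-trans (m≤n⇒p^m∣p^n p (∣⇒≤ (n≡0[mod]⇒∣ (a≈b p pp k 0 a-exact (∤⇒exactPower-0 p∤b))))) p^k∣a

[m*n]^k≡m^k*n^k : ∀ m n k → (m * n) ^ k ≡ m ^ k * n ^ k
[m*n]^k≡m^k*n^k m n zero = refl
[m*n]^k≡m^k*n^k m n (suc k) = begin
  m * n * (m * n) ^ k         ≡⟨ cong (m * n *_) ([m*n]^k≡m^k*n^k m n k) ⟩
  m * n * (m ^ k * n ^ k)     ≡⟨ [m*n]*[o*p]≡[m*o]*[n*p] m n (m ^ k) (n ^ k) ⟩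
  m * m ^ k * (n * n ^ k)     ∎
  where open ≡-Reasoning

CommonCofactor : ℕ → ℕ → ℕ → Set
CommonCofactor q a b = ∃[ r ] ∃[ u ] ∃[ v ] (a ≡ u ^ q * r × b ≡ v ^ q * r)

module _ {q : ℕ} where

  commonCofactor-sym : ∀ {a b} → CommonCofactor q a b → CommonCofactor q b a
  commonCofactor-sym (r , u , v , a≡ , b≡) = r , v , u , b≡ , a≡

  commonCofactor-*ʳ : ∀ {a b} c → CommonCofactor q a b → CommonCofactor q (a * c) (b * c)
  commonCofactor-*ʳ c (r , u , v , refl , refl) =
    r * c , u , v , *-assoc (u ^ q) r c , *-assoc (v ^ q) r c

  commonCofactor-^ˡ : ∀ {a b} c → CommonCofactor q a b → CommonCofactor q (a * c ^ q) b
  commonCofactor-^ˡ c (r , u , v , refl , refl) = r , u * c , v , absorb , refl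
    where
    open ≡-Reasoning
    absorb : u ^ q * r * c ^ q ≡ (u * c) ^ q * r
    absorb = begin
      u ^ q * r * c ^ q   ≡⟨ *-assoc (u ^ q) r (c ^ q) ⟩
      u ^ q * (r * c ^ q) ≡⟨ cong (u ^ q *_) (*-comm r (c ^ q)) ⟩
      u ^ q * (c ^ q * r) ≡⟨ *-assoc (u ^ q) (c ^ q) r ⟨
      u ^ q * c ^ q * r   ≡⟨ cong (_* r) ([m*n]^k≡m^k*n^k u c q) ⟨
      (u * c) ^ q * r     ∎

  record Reduction (a b : ℕ) : Set where
    field
      {a′ b′} : ℕ
      a′≢0    : NonZero a′
      b′≢0    : NonZero b′
      smaller : a′ + b′ < a + b
      related : a′ ≈[ q ] b′
      lift    : CommonCofactor q a′ b′ → CommonCofactor q a b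

  reduction-sym : ∀ {a b} → Reduction b a → Reduction a b
  reduction-sym {a} {b} r = record
    { a′≢0 = b′≢0 ; b′≢0 = a′≢0
    ; smaller = subst₂ _<_ (+-comm a′ b′) (+-comm b a) smaller
    ; related = ≈-sym related
    ; lift = commonCofactor-sym ∘ lift ∘ commonCofactor-sym
    }
    where open Reduction r

  reduce-common : ∀ {p a b} → .{{NonZero a}} → .{{NonZero b}} → Prime p →
                  p ∣ a → p ∣ b → a ≈[ q ] b → Reduction a b
  reduce-common {p} pp (divides a′ refl) (divides b′ refl) a≈b = record
    { a′≢0 = m*n≢0⇒m≢0 a′ ; b′≢0 = m*n≢0⇒m≢0 b′
    ; smaller = +-mono-< (m<m*n a′ p {{m*n≢0⇒m≢0 a′}} 1<p) (m<m*n b′ p {{m*n≢0⇒m≢0 b′}} 1<p)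
    ; related = ≈-divide {q} {i = 1} {1} pp (as-power a′) (as-power b′) (≡[mod]-refl 1) a≈b
    ; lift = commonCofactor-*ʳ p
    }
    where
    1<p : 1 < p
    1<p = nonTrivial⇒n>1 p {{prime⇒nonTrivial pp}}
    as-power : ∀ c → c * p ≡ c * p ^ 1
    as-power c = cong (c *_) (sym (*-identityʳ p))

  reduce-coprime : ∀ {p a b} → .{{NonZero q}} → .{{NonZero a}} → .{{NonZero b}} → Prime p →
                   p ∣ a → ¬ p ∣ b → a ≈[ q ] b → Reduction a b
  reduce-coprime {p} {a} {b} pp p∣a p∤b a≈b with ≈-∣∧∤⇒^∣ pp p∣a p∤b a≈b
  ... | divides a′ refl = record
    { a′≢0 = m*n≢0⇒m≢0 a′ ; b′≢0 = ≢-nonZero (≢-nonZero⁻¹ b)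
    ; smaller = +-monoˡ-< b (m<m*n a′ (p ^ q) {{m*n≢0⇒m≢0 a′}} 1<p^q)
    ; related = ≈-divide {q} {i = q} {0} pp refl (sym (*-identityʳ b)) q≡0[mod]q a≈b
    ; lift = commonCofactor-^ˡ p
    }
    where
    1<p^q : 1 < p ^ q
    1<p^q = ^-monoʳ-< p (nonTrivial⇒n>1 p {{prime⇒nonTrivial pp}}) (>-nonZero⁻¹ q)

  ≈-reduce : ∀ {a b} → .{{NonZero q}} → .{{NonZero a}} → .{{NonZero b}} → a ≈[ q ] b →
             (a ≡ 1 × b ≡ 1) ⊎ Reduction a b
  ≈-reduce {a} {b} a≈b with ≡1⊎primeDivisor a | ≡1⊎primeDivisor b
  ... | inj₁ a≡1 | inj₁ b≡1 = inj₁ (a≡1 , b≡1)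
  ... | inj₂ (p , pp , p∣a) | _ with p ∣? b
  ...   | yes p∣b = inj₂ (reduce-common pp p∣a p∣b a≈b)
  ...   | no p∤b = inj₂ (reduce-coprime pp p∣a p∤b a≈b)
  ≈-reduce a≈b | inj₁ refl | inj₂ (p , pp , p∣b) =
    inj₂ (reduction-sym (reduce-coprime pp p∣b (prime∤1 pp) (≈-sym a≈b)))

  ≈⇒commonCofactor : .{{NonZero q}} → ∀ a b → .{{NonZero a}} → .{{NonZero b}} →
                     a ≈[ q ] b → CommonCofactor q a b
  ≈⇒commonCofactor a b = go a b (<-wellFounded (a + b))
    where
    1≡1^q*1 : 1 ≡ 1 ^ q * 1
    1≡1^q*1 = sym (trans (*-identityʳ (1 ^ q)) (^-zeroˡ q))
    go : ∀ a b → .{{NonZero a}} → .{{NonZero b}} → Acc _<_ (a + b) → a ≈[ q ] b →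
         CommonCofactor q a b
    go a b (acc rec) a≈b with ≈-reduce a≈b
    ... | inj₁ (refl , refl) = 1 , 1 , 1 , 1≡1^q*1 , 1≡1^q*1
    ... | inj₂ r = lift (go _ _ {{a′≢0}} {{b′≢0}} (rec smaller) related)
      where open Reduction r

[i*j]^n≡i^n*j^n : ∀ i j n → (i ℤ.* j) ℤ.^ n ≡ i ℤ.^ n ℤ.* j ℤ.^ n
[i*j]^n≡i^n*j^n i j zero = refl
[i*j]^n≡i^n*j^n i j (suc n) = begin
  i ℤ.* j ℤ.* (i ℤ.* j) ℤ.^ n         ≡⟨ cong (i ℤ.* j ℤ.*_) ([i*j]^n≡i^n*j^n i j n) ⟩
  i ℤ.* j ℤ.* (i ℤ.^ n ℤ.* j ℤ.^ n)   ≡⟨ interchange i j (i ℤ.^ n) (j ℤ.^ n) ⟩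
  i ℤ.* i ℤ.^ n ℤ.* (j ℤ.* j ℤ.^ n)   ∎
  where
  open ≡-Reasoning
  interchange : ∀ a b c d → a ℤ.* b ℤ.* (c ℤ.* d) ≡ a ℤ.* c ℤ.* (b ℤ.* d)
  interchange = solve-∀

pos-^ : ∀ m n → + (m ^ n) ≡ (+ m) ℤ.^ n
pos-^ m zero = refl
pos-^ m (suc n) = trans (ℤ.pos-* m (m ^ n)) (cong (+ m ℤ.*_) (pos-^ m n))

[-i]^n≡-[i^n] : ∀ n → n % 2 ≡ 1 → ∀ i → (- i) ℤ.^ n ≡ - (i ℤ.^ n)
[-i]^n≡-[i^n] 1 _ i = sym (ℤ.neg-distribˡ-* i 1ℤ)
[-i]^n≡-[i^n] (suc (suc n)) n-odd i = begin
  - i ℤ.* (- i ℤ.* (- i) ℤ.^ n)   ≡⟨ cong (λ x → - i ℤ.* (- i ℤ.* x)) ([-i]^n≡-[i^n] n n-odd i) ⟩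
  - i ℤ.* (- i ℤ.* - (i ℤ.^ n))   ≡⟨ signs i (i ℤ.^ n) ⟩
  - (i ℤ.* (i ℤ.* i ℤ.^ n))       ∎
  where
  open ≡-Reasoning
  signs : ∀ a b → - a ℤ.* (- a ℤ.* - b) ≡ - (a ℤ.* (a ℤ.* b))
  signs = solve-∀

∣i∣≡m^n*r⇒i≡j^n*r : ∀ {n} → n % 2 ≡ 1 → ∀ i {m r} → ℤ.∣ i ∣ ≡ m ^ n * r →
                    ∃[ j ] (i ≡ j ℤ.^ n ℤ.* + r)
∣i∣≡m^n*r⇒i≡j^n*r {n} _ (+ _) {m} {r} refl = + m , pos-m^n*r
  where
  pos-m^n*r : + (m ^ n * r) ≡ (+ m) ℤ.^ n ℤ.* + r
  pos-m^n*r = trans (ℤ.pos-* (m ^ n) r) (cong (ℤ._* + r) (pos-^ m n))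
∣i∣≡m^n*r⇒i≡j^n*r {n} n-odd i@(-[1+ _ ]) {m} {r} ∣i∣≡ = - + m , (begin
  - + ℤ.∣ i ∣                ≡⟨ cong (-_ ∘ +_) ∣i∣≡ ⟩
  - + (m ^ n * r)            ≡⟨ cong -_ (ℤ.pos-* (m ^ n) r) ⟩
  - (+ (m ^ n) ℤ.* + r)      ≡⟨ ℤ.neg-distribˡ-* (+ (m ^ n)) (+ r) ⟩
  - + (m ^ n) ℤ.* + r        ≡⟨ cong (λ x → - x ℤ.* + r) (pos-^ m n) ⟩
  - (+ m) ℤ.^ n ℤ.* + r      ≡⟨ cong (ℤ._* + r) ([-i]^n≡-[i^n] n n-odd (+ m)) ⟨
  (- + m) ℤ.^ n ℤ.* + r      ∎)
  where open ≡-Reasoning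

∣i-j⇒∣i^n-j^n : ∀ {k i j} n → k ℤS.∣ i ℤ.- j → k ℤS.∣ i ℤ.^ n ℤ.- j ℤ.^ n
∣i-j⇒∣i^n-j^n {k} zero _ = ℤS.divides 0ℤ (sym (ℤ.*-zeroˡ k))
∣i-j⇒∣i^n-j^n {k} {i} {j} (suc n) k∣i-j =
  subst (k ℤS.∣_) (sym (telescope i j (i ℤ.^ n) (j ℤ.^ n)))
    (ℤS.∣m∣n⇒∣m+n (ℤS.∣n⇒∣m*n i (∣i-j⇒∣i^n-j^n n k∣i-j)) (ℤS.∣n⇒∣m*n (j ℤ.^ n) k∣i-j))
  where
  telescope : ∀ a b c d → a ℤ.* c ℤ.- b ℤ.* d ≡ a ℤ.* (c ℤ.- d) ℤ.+ d ℤ.* (a ℤ.- b)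
  telescope = solve-∀

pos-1+m*n≡k*l : ∀ m n k l → 1 + m * n ≡ k * l → 1ℤ ℤ.+ + m ℤ.* + n ≡ + k ℤ.* + l
pos-1+m*n≡k*l m n k l eq = begin
  1ℤ ℤ.+ + m ℤ.* + n   ≡⟨ cong (ℤ._+_ 1ℤ) (ℤ.pos-* m n) ⟨
  1ℤ ℤ.+ + (m * n)     ≡⟨ ℤ.pos-+ 1 (m * n) ⟨
  + (1 + m * n)        ≡⟨ cong +_ eq ⟩
  + (k * l)            ≡⟨ ℤ.pos-* k l ⟩
  + k ℤ.* + l          ∎
  where open ≡-Reasoning

inverse-mod-prime : ∀ {p} → Prime p → ∀ i → i ≢ 0ℤ → ℤ.∣ i ∣ < p →
                    ∃[ j ] (+ p ℤS.∣ j ℤ.* i ℤ.- 1ℤ)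
inverse-mod-prime pp (+ zero) i≢0 _ = contradiction refl i≢0
inverse-mod-prime {p} pp (+ v@(suc _)) _ v<p with coprime-Bézout (prime⇒coprime pp v<p)
... | Bézout.+- x y 1+yv≡xp = - + y , ℤS.divides (- + x) (begin
  - + y ℤ.* + v ℤ.- 1ℤ        ≡⟨ negate (+ y) (+ v) ⟩
  - (1ℤ ℤ.+ + y ℤ.* + v)      ≡⟨ cong -_ (pos-1+m*n≡k*l y v x p 1+yv≡xp) ⟩
  - (+ x ℤ.* + p)             ≡⟨ ℤ.neg-distribˡ-* (+ x) (+ p) ⟩
  - + x ℤ.* + p               ∎)
  where
  open ≡-Reasoning
  negate : ∀ a b → - a ℤ.* b ℤ.- 1ℤ ≡ - (1ℤ ℤ.+ a ℤ.* b)
  negate = solve-∀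
... | Bézout.-+ x y 1+xp≡yv = + y , ℤS.divides (+ x) (begin
  + y ℤ.* + v ℤ.- 1ℤ            ≡⟨ cong (ℤ._- 1ℤ) (pos-1+m*n≡k*l x p y v 1+xp≡yv) ⟨
  1ℤ ℤ.+ + x ℤ.* + p ℤ.- 1ℤ     ≡⟨ cancel (+ x ℤ.* + p) ⟩
  + x ℤ.* + p                   ∎)
  where
  open ≡-Reasoning
  cancel : ∀ a → 1ℤ ℤ.+ a ℤ.- 1ℤ ≡ a
  cancel = solve-∀
inverse-mod-prime pp -[1+ n ] _ v<p with inverse-mod-prime pp (+ suc n) (λ ()) v<p
... | j , p∣jv-1 = - j , subst (λ x → _ ℤS.∣ x ℤ.- 1ℤ) (negate-both j (+ suc n)) p∣jv-1
  where
  negate-both : ∀ a b → a ℤ.* b ≡ - a ℤ.* - b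
  negate-both = solve-∀

powerModP-transfer : ∀ {q p} U V W R → + p ℤS.∣ W ℤ.* V ℤ.- 1ℤ →
                     PowerModP q (V ℤ.^ q ℤ.* R) p → PowerModP q (U ℤ.^ q ℤ.* R) p
powerModP-transfer {q} {p} U V W R p∣WV-1 (y , p∣y^q-V^qR) =
  U ℤ.* W ℤ.* y ,
  ℤS.∣⇒∣ᵤ (subst (+ p ℤS.∣_) (sym decomposition)
    (ℤS.∣m∣n⇒∣m+n (ℤS.∣n⇒∣m*n (Uq ℤ.* Wq) (ℤS.∣ᵤ⇒∣ {i = yq ℤ.- Vq ℤ.* R} p∣y^q-V^qR))
                  (ℤS.∣n⇒∣m*n (Uq ℤ.* R) p∣W^qV^q-1)))
  where
  open ≡-Reasoning
  Uq = U ℤ.^ q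
  Vq = V ℤ.^ q
  Wq = W ℤ.^ q
  yq = y ℤ.^ q
  p∣W^qV^q-1 : + p ℤS.∣ Wq ℤ.* Vq ℤ.- 1ℤ
  p∣W^qV^q-1 = subst₂ (λ x z → + p ℤS.∣ x ℤ.- z) ([i*j]^n≡i^n*j^n W V q) (ℤ.^-zeroˡ q)
                 (∣i-j⇒∣i^n-j^n q p∣WV-1)
  regroup : ∀ a b c d r →
            a ℤ.* b ℤ.* c ℤ.- a ℤ.* r ≡ a ℤ.* b ℤ.* (c ℤ.- d ℤ.* r) ℤ.+ a ℤ.* r ℤ.* (b ℤ.* d ℤ.- 1ℤ)
  regroup = solve-∀
  decomposition : (U ℤ.* W ℤ.* y) ℤ.^ q ℤ.- Uq ℤ.* R
                ≡ Uq ℤ.* Wq ℤ.* (yq ℤ.- Vq ℤ.* R) ℤ.+ Uq ℤ.* R ℤ.* (Wq ℤ.* Vq ℤ.- 1ℤ)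
  decomposition = begin
    (U ℤ.* W ℤ.* y) ℤ.^ q ℤ.- Uq ℤ.* R
      ≡⟨ cong (ℤ._- Uq ℤ.* R) ([i*j]^n≡i^n*j^n (U ℤ.* W) y q) ⟩
    (U ℤ.* W) ℤ.^ q ℤ.* yq ℤ.- Uq ℤ.* R
      ≡⟨ cong (λ x → x ℤ.* yq ℤ.- Uq ℤ.* R) ([i*j]^n≡i^n*j^n U W q) ⟩
    Uq ℤ.* Wq ℤ.* yq ℤ.- Uq ℤ.* R
      ≡⟨ regroup Uq Wq yq Vq R ⟩
    Uq ℤ.* Wq ℤ.* (yq ℤ.- Vq ℤ.* R) ℤ.+ Uq ℤ.* R ℤ.* (Wq ℤ.* Vq ℤ.- 1ℤ) ∎

Dominates : ℕ → ℤ → ℤ → Set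
Dominates q b₁ b₂ = ∃[ N ] (∀ p → Prime p → N < p → PowerModP q b₂ p → PowerModP q b₁ p)

cofactor⇒dominates : ∀ {q b₁ b₂} U V R → b₁ ≡ U ℤ.^ q ℤ.* R → b₂ ≡ V ℤ.^ q ℤ.* R → V ≢ 0ℤ →
                     Dominates q b₁ b₂
cofactor⇒dominates {q} U V R refl refl V≢0 = ℤ.∣ V ∣ , λ p pp ∣V∣<p →
  let (W , p∣WV-1) = inverse-mod-prime pp V V≢0 ∣V∣<p in powerModP-transfer {q} U V W R p∣WV-1

locallyQthPowerSet-removeDominated :
  ∀ {q S b₁ b₂} → LocallyQthPowerSet q S → S b₁ → b₁ ≢ b₂ → Dominates q b₁ b₂ →
  LocallyQthPowerSet q (λ c → S c × c ≢ b₂)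
locallyQthPowerSet-removeDominated {q} {S} {b₁} {b₂}
  (noPower , N , covered) Sb₁ b₁≢b₂ (M , dominated) =
  (λ b (Sb , _) → noPower b Sb) ,
  N + M , λ p pp N+M<p → cover p pp (covered p pp (≤-<-trans (m≤m+n N M) N+M<p))
                                     (dominated p pp (≤-<-trans (m≤n+m M N) N+M<p))
  where
  cover : ∀ p → Prime p → ∃[ b ] (S b × PowerModP q b p) →
          (PowerModP q b₂ p → PowerModP q b₁ p) → ∃[ b ] ((S b × b ≢ b₂) × PowerModP q b p)
  cover p pp (b , Sb , b-power) b₂-power⇒b₁-power with b ℤ.≟ b₂
  ... | yes refl = b₁ , (Sb₁ , b₁≢b₂) , b₂-power⇒b₁-power b-power
  ... | no b≢b₂ = b , (Sb , b≢b₂) , b-power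

∣i∣-nonZero : ∀ {i} → i ≢ 0ℤ → NonZero ℤ.∣ i ∣
∣i∣-nonZero i≢0 = ≢-nonZero (i≢0 ∘ ℤ.∣i∣≡0⇒i≡0)

∼⇒dominates : ∀ {q b₁ b₂} → q % 2 ≡ 1 → b₁ ≢ 0ℤ → b₂ ≢ 0ℤ → b₁ ∼[ q ] b₂ → Dominates q b₁ b₂
∼⇒dominates {q@(suc _)} {b₁} {b₂} q-odd b₁≢0 b₂≢0 b₁∼b₂
  with ≈⇒commonCofactor ℤ.∣ b₁ ∣ ℤ.∣ b₂ ∣ {{∣i∣-nonZero b₁≢0}} {{∣i∣-nonZero b₂≢0}} b₁∼b₂
... | r , u , v , ∣b₁∣≡ , ∣b₂∣≡
  with ∣i∣≡m^n*r⇒i≡j^n*r {q} q-odd b₁ {u} {r} ∣b₁∣≡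
     | ∣i∣≡m^n*r⇒i≡j^n*r {q} q-odd b₂ {v} {r} ∣b₂∣≡
... | U , b₁≡ | V , b₂≡ = cofactor⇒dominates {q} U V (+ r) b₁≡ b₂≡ V≢0
  where
  V≢0 : V ≢ 0ℤ
  V≢0 refl = b₂≢0 b₂≡

minimal⇒≁ : ∀ {q B} → q % 2 ≡ 1 → All (λ b → b ≢ 0ℤ) B → MinimalLocallyQthPowerSet q B →
            ∀ {b₁ b₂} → b₁ ∈ B → b₂ ∈ B → b₁ ≢ b₂ → ¬ b₁ ∼[ q ] b₂
minimal⇒≁ {q} q-odd nonzero (local , essential) b₁∈B b₂∈B b₁≢b₂ b₁∼b₂ =
  essential _ b₂∈B (locallyQthPowerSet-removeDominated {q} local b₁∈B b₁≢b₂
    (∼⇒dominates {q} q-odd (All.lookup nonzero b₁∈B) (All.lookup nonzero b₂∈B) b₁∼b₂))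

numClasses-length : ∀ {R B} → Unique B → (∀ {x y} → x ∈ B → y ∈ B → x ≢ y → ¬ R x y) →
                    NumClasses R B (length B)
numClasses-length [] _ = nc-[]
numClasses-length (b∉B ∷ unique) ≁ =
  nc-new (All¬⇒¬Any (All.tabulate λ c∈B → ≁ (here refl) (there c∈B) (All.lookup b∉B c∈B)))
         (numClasses-length unique λ x∈B y∈B → ≁ (there x∈B) (there y∈B))

lemma2p2 : (q : ℕ) → Prime q → q % 2 ≡ 1 →
    (B : List ℤ) → Unique B → All (λ b → b ≢ 0ℤ) B →
    MinimalLocallyQthPowerSet q B →
    NumClasses (λ b₁ b₂ → b₁ ∼[ q ] b₂) B (length B)
lemma2p2 q _ q-odd B unique nonzero minimal =
  numClasses-length unique (minimal⇒≁ q-odd nonzero minimal)
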